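{- Let $\mathcal{O}$ be a set of $n$ objects, $v\ge1$, $0\le q\le1$. Let $I$ be a random $n\times v$ $0/1$ matrix with independent entries each equal to $1$ with probability $q$, defining pools $Q_j=\{x: I_{x,j}=1\}$, $j=1,\dots,v$. Let $P\subseteq\mathcal{O}$ be a random set of positive objects, independent of $I$, and let $p(i)$ be the probability that $|P|=i$. Then the expected number $\tilde d(I)$ of unresolved negative objects (expectation over $I$ and $P$) equals $$\tilde d(I)=\sum_{i=0}^n p(i)(n-i)\bigl(1-q(1-q)^i\bigr)^v.$$
   Context: A pool is positive if it intersects $P$. An object $x$ is a candidate positive if every pool containing $x$ is positive; it is an unresolved negative if it is a candidate positive and $x\notin P$.
   Formalization: The probability q is rational, and the distribution of the random set P of positive objects takes rational values. -}

module Defs where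

open import Data.Nat using (ℕ; zero; suc)
open import Data.Fin using (Fin; zero; suc)
open import Data.Bool using (Bool; true; false; _∧_; not; if_then_else_)
open import Data.List using (List; []; _∷_; map; concatMap; allFin; foldr; filter; length)
open import Data.Integer using (+_)
open import Data.Rational using (ℚ; 0ℚ; 1ℚ; _+_; _*_; _-_)
open import Data.Bool.ListAction using (any; all)

ℕ→ℚ : ℕ → ℚ
ℕ→ℚ n = + n Data.Rational./ 1

_^ℚ_ : ℚ → ℕ → ℚ
x ^ℚ zero = 1ℚ
x ^ℚ suc k = x * (x ^ℚ k)

Σ[_]_ : {A : Set} → List A → (A → ℚ) → ℚ
Σ[ xs ] f = foldr (λ a s → f a + s) 0ℚ xs

Π[_]_ : {A : Set} → List A → (A → ℚ) → ℚ
Π[ xs ] f = foldr (λ a s → f a * s) 1ℚ xs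

Σ≤ : ℕ → (ℕ → ℚ) → ℚ
Σ≤ zero f = f zero
Σ≤ (suc n) f = Σ≤ n f + f (suc n)

allFuns : {A : Set} → (n : ℕ) → List A → List (Fin n → A)
allFuns zero xs = (λ ()) ∷ []
allFuns (suc n) xs =
  concatMap (λ a → map (λ f → λ { zero → a ; (suc i) → f i }) (allFuns n xs)) xs

bools : List Bool
bools = true ∷ false ∷ []

-- subsets of the object set 𝒪 = Fin n, as characteristic functions
Subset : ℕ → Set
Subset n = Fin n → Bool

allSubsets : (n : ℕ) → List (Subset n)
allSubsets n = allFuns n bools

card : {n : ℕ} → Subset n → ℕ
card {n} P = length (filter (λ x → P x Data.Bool.≟ true) (allFin n))

-- n × v 0/1 test matrices; I x j = true means object x is in pool Q_j
Matrix : ℕ → ℕ → Set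
Matrix n v = Fin n → Fin v → Bool

allMatrices : (n v : ℕ) → List (Matrix n v)
allMatrices n v = allFuns n (allFuns v bools)

entryProb : ℚ → Bool → ℚ
entryProb q true = q
entryProb q false = 1ℚ - q

matrixProb : {n v : ℕ} → ℚ → Matrix n v → ℚ
matrixProb {n} {v} q I = Π[ allFin n ] (λ x → Π[ allFin v ] (λ j → entryProb q (I x j)))

positivePool : {n v : ℕ} → Matrix n v → Subset n → Fin v → Bool
positivePool {n} I P j = any (λ x → I x j ∧ P x) (allFin n)

candidatePositive : {n v : ℕ} → Matrix n v → Subset n → Fin n → Bool
candidatePositive {n} {v} I P x =
  all (λ j → if I x j then positivePool I P j else true) (allFin v)

unresolvedNegative : {n v : ℕ} → Matrix n v → Subset n → Fin n → Bool
unresolvedNegative I P x = candidatePositive I P x ∧ not (P x)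

numUnresolved : {n v : ℕ} → Matrix n v → Subset n → ℕ
numUnresolved {n} I P =
  length (filter (λ x → unresolvedNegative I P x Data.Bool.≟ true) (allFin n))

-- expected number of unresolved negatives, over I ~ Bernoulli(q)^{n×v}
-- and P ~ μ independent of I
expectedUnresolved : (n v : ℕ) → ℚ → (Subset n → ℚ) → ℚ
expectedUnresolved n v q μ =
  Σ[ allSubsets n ] (λ P → Σ[ allMatrices n v ] (λ I →
    μ P * matrixProb q I * ℕ→ℚ (numUnresolved I P)))

sizeProb : {n : ℕ} → (Subset n → ℚ) → ℕ → ℚ
sizeProb {n} μ i =
  Σ[ allSubsets n ] (λ P → if card P Data.Nat.≡ᵇ i then μ P else 0ℚ)

{-# OPTIONS --safe #-}

-- Fix the set P of positives. The columns of I are independent pools, each containing every object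
-- independently with probability q, and a negative object x survives a pool unless the pool contains
-- x and misses P, which happens with probability q(1-q)^|P|. So x is a candidate positive with
-- probability (1 - q(1-q)^|P|)^v; summing over the n - |P| negatives and grouping the sets P by
-- their size gives the formula. Independence is used in the form: a weighted sum over all functions
-- Fin n → A of a product of coordinatewise factors is the product of the coordinatewise sums.

module Submission where

open import Defs
open import Data.Nat using (ℕ; _≥_; _∸_)
open import Data.Rational using (ℚ; 0ℚ; 1ℚ; _≤_; _+_; _*_; _-_)
open import Relation.Binary.PropositionalEquality using (_≡_)

import Data.Nat as ℕ
open import Data.Nat using (zero; suc; _≡ᵇ_)
open import Data.Nat.Properties
  using (+-∸-assoc; m≤n⇒m<n∨m≡n; ≤-pred; <⇒≢; ≤-refl; m≤n⇒m≤1+n)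
open import Data.Fin using (Fin; zero; suc; _≟_)
open import Data.Bool using (Bool; true; false; _∧_; not; if_then_else_) renaming (_≟_ to _≟ᵇ_)
open import Data.Bool.ListAction using (any; all; or)
open import Data.List using (List; []; _∷_; _++_; map; concatMap; tabulate; allFin; filter; length)
open import Data.List.Properties using (length-filter; length-tabulate; map-cong)
open import Data.Vec.Functional using () renaming (_∷_ to _∷′_)
open import Data.Sum using (inj₁; inj₂)
open import Function using (_∘_; id)
open import Relation.Binary.Core using (_Preserves_⟶_)
open import Relation.Binary.PropositionalEquality
  using (refl; sym; trans; cong; cong₂; subst; _≗_; _≢_; module ≡-Reasoning)
open import Relation.Nullary using (does; yes; no)
open import Relation.Nullary.Decidable using (dec-true; dec-false)
import Data.Rational.Properties as ℚ
open import Data.Rational using (_/_)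
import Data.Integer as ℤ
import Data.Integer.Properties as ℤ
import Data.Nat.Coprimality as C
open import Data.Rational.Solver using (module +-*-Solver)
open +-*-Solver using (solve; _:+_; _:*_; _:-_; _:=_; con)
open import Algebra.Properties.CommutativeMonoid.Sum ℚ.*-1-commutativeMonoid
  using ()
  renaming (sum to ∏; sum-cong-≗ to ∏-cong; ∑-distrib-+ to ∏-distrib-*; sum-replicate-zero to ∏-1)

open ≡-Reasoning

private variable
  A B : Set
  n v : ℕ

Σ-cong : (xs : List A) {f g : A → ℚ} → f ≗ g → Σ[ xs ] f ≡ Σ[ xs ] g
Σ-cong []       f≗g = refl
Σ-cong (a ∷ xs) f≗g = cong₂ _+_ (f≗g a) (Σ-cong xs f≗g)

Σ-++ : (xs ys : List A) (f : A → ℚ) → Σ[ xs ++ ys ] f ≡ Σ[ xs ] f + Σ[ ys ] f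
Σ-++ []       ys f = sym (ℚ.+-identityˡ _)
Σ-++ (a ∷ xs) ys f = trans (cong (f a +_) (Σ-++ xs ys f)) (sym (ℚ.+-assoc (f a) _ _))

Σ-map : (h : A → B) (xs : List A) (f : B → ℚ) → Σ[ map h xs ] f ≡ Σ[ xs ] (f ∘ h)
Σ-map h []       f = refl
Σ-map h (a ∷ xs) f = cong (f (h a) +_) (Σ-map h xs f)

Σ-concatMap : (h : A → List B) (xs : List A) (f : B → ℚ) →
  Σ[ concatMap h xs ] f ≡ Σ[ xs ] (λ a → Σ[ h a ] f)
Σ-concatMap h []       f = refl
Σ-concatMap h (a ∷ xs) f =
  trans (Σ-++ (h a) (concatMap h xs) f) (cong (Σ[ h a ] f +_) (Σ-concatMap h xs f))

Σ-zero : (xs : List A) → Σ[ xs ] (λ _ → 0ℚ) ≡ 0ℚ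
Σ-zero []       = refl
Σ-zero (a ∷ xs) = trans (ℚ.+-identityˡ _) (Σ-zero xs)

Σ-distrib-+ : (xs : List A) (f g : A → ℚ) → Σ[ xs ] (λ a → f a + g a) ≡ Σ[ xs ] f + Σ[ xs ] g
Σ-distrib-+ []       f g = refl
Σ-distrib-+ (a ∷ xs) f g =
  trans (cong (f a + g a +_) (Σ-distrib-+ xs f g))
        (solve 4 (λ x y z w → x :+ y :+ (z :+ w) := x :+ z :+ (y :+ w)) refl (f a) (g a) _ _)

Σ-distrib-minus : (xs : List A) (f g : A → ℚ) → Σ[ xs ] (λ a → f a - g a) ≡ Σ[ xs ] f - Σ[ xs ] g
Σ-distrib-minus []       f g = refl
Σ-distrib-minus (a ∷ xs) f g =
  trans (cong (f a - g a +_) (Σ-distrib-minus xs f g))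
        (solve 4 (λ x y z w → x :- y :+ (z :- w) := x :+ z :- (y :+ w)) refl (f a) (g a) _ _)

*-distribˡ-Σ : (c : ℚ) (xs : List A) (f : A → ℚ) → c * Σ[ xs ] f ≡ Σ[ xs ] (λ a → c * f a)
*-distribˡ-Σ c []       f = ℚ.*-zeroʳ c
*-distribˡ-Σ c (a ∷ xs) f =
  trans (ℚ.*-distribˡ-+ c (f a) _) (cong (c * f a +_) (*-distribˡ-Σ c xs f))

*-distribʳ-Σ : (c : ℚ) (xs : List A) (f : A → ℚ) → Σ[ xs ] f * c ≡ Σ[ xs ] (λ a → f a * c)
*-distribʳ-Σ c xs f =
  trans (ℚ.*-comm _ c) (trans (*-distribˡ-Σ c xs f) (Σ-cong xs (λ a → ℚ.*-comm c (f a))))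

Σ-comm : (xs : List A) (ys : List B) (f : A → B → ℚ) →
  Σ[ xs ] (λ a → Σ[ ys ] (f a)) ≡ Σ[ ys ] (λ b → Σ[ xs ] (λ a → f a b))
Σ-comm []       ys f = sym (Σ-zero ys)
Σ-comm (a ∷ xs) ys f =
  trans (cong (Σ[ ys ] (f a) +_) (Σ-comm xs ys f)) (sym (Σ-distrib-+ ys (f a) _))

Π-tabulate : (f : Fin n → A) (g : A → ℚ) → Π[ tabulate f ] g ≡ ∏ (g ∘ f)
Π-tabulate {n = zero}  f g = refl
Π-tabulate {n = suc n} f g = cong (g (f zero) *_) (Π-tabulate (f ∘ suc) g)

∏-const : (a : ℚ) → ∏ (λ (_ : Fin n) → a) ≡ a ^ℚ n
∏-const {n = zero}  a = refl
∏-const {n = suc n} a = cong (a *_) (∏-const {n = n} a)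

∏-δ : (x : Fin n) (f : Fin n → ℚ) → ∏ (λ y → if does (x ≟ y) then f y else 1ℚ) ≡ f x
∏-δ {n = suc n} zero    f = trans (cong (f zero *_) (∏-1 n)) (ℚ.*-identityʳ (f zero))
∏-δ {n = suc n} (suc x) f = trans (ℚ.*-identityˡ _) (∏-δ x (f ∘ suc))

𝟙 : Bool → ℚ
𝟙 true  = 1ℚ
𝟙 false = 0ℚ

𝟙-∧ : ∀ a b → 𝟙 (a ∧ b) ≡ 𝟙 a * 𝟙 b
𝟙-∧ true  b = sym (ℚ.*-identityˡ (𝟙 b))
𝟙-∧ false b = sym (ℚ.*-zeroˡ (𝟙 b))

𝟙-all : (p : A → Bool) (xs : List A) → 𝟙 (all p xs) ≡ Π[ xs ] (𝟙 ∘ p)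
𝟙-all p []       = refl
𝟙-all p (a ∷ xs) = trans (𝟙-∧ (p a) _) (cong (𝟙 (p a) *_) (𝟙-all p xs))

𝟙-any : (p : A → Bool) (xs : List A) → 𝟙 (any p xs) ≡ 1ℚ - Π[ xs ] (λ a → 𝟙 (not (p a)))
𝟙-any p []       = refl
𝟙-any p (a ∷ xs) with p a
... | true  = solve 1 (λ z → con 1ℚ := con 1ℚ :- con 0ℚ :* z) refl (Π[ xs ] (𝟙 ∘ not ∘ p))
... | false = trans (𝟙-any p xs) (cong (1ℚ -_) (sym (ℚ.*-identityˡ (Π[ xs ] (𝟙 ∘ not ∘ p)))))

ℕ→ℚ-suc : ∀ k → ℕ→ℚ (suc k) ≡ 1ℚ + ℕ→ℚ k
ℕ→ℚ-suc k rewrite ℚ.normalize-coprime (C.sym (C.1-coprimeTo k)) =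
  cong (λ m → (ℤ.+ 1 ℤ.+ m) / 1) (sym (ℤ.*-identityʳ (ℤ.+ k)))

count : (A → Bool) → List A → ℕ
count b xs = length (filter (λ a → b a ≟ᵇ true) xs)

count≤length : (b : A → Bool) (xs : List A) → count b xs ℕ.≤ length xs
count≤length b = length-filter (λ a → b a ≟ᵇ true)

ℕ→ℚ-count : (b : A → Bool) (xs : List A) → ℕ→ℚ (count b xs) ≡ Σ[ xs ] (𝟙 ∘ b)
ℕ→ℚ-count b []       = refl
ℕ→ℚ-count b (a ∷ xs) with b a
... | true  = trans (ℕ→ℚ-suc (count b xs)) (cong (1ℚ +_) (ℕ→ℚ-count b xs))
... | false = trans (ℕ→ℚ-count b xs) (sym (ℚ.+-identityˡ _))

ℕ→ℚ-length∸count : (b : A → Bool) (xs : List A) →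
  ℕ→ℚ (length xs ∸ count b xs) ≡ Σ[ xs ] (λ a → 𝟙 (not (b a)))
ℕ→ℚ-length∸count b []       = refl
ℕ→ℚ-length∸count b (a ∷ xs) with b a
... | true  = trans (ℕ→ℚ-length∸count b xs) (sym (ℚ.+-identityˡ _))
... | false = begin
    ℕ→ℚ (suc (length xs) ∸ count b xs)
  ≡⟨ cong ℕ→ℚ (+-∸-assoc 1 (count≤length b xs)) ⟩
    ℕ→ℚ (suc (length xs ∸ count b xs))
  ≡⟨ ℕ→ℚ-suc (length xs ∸ count b xs) ⟩
    1ℚ + ℕ→ℚ (length xs ∸ count b xs)
  ≡⟨ cong (1ℚ +_) (ℕ→ℚ-length∸count b xs) ⟩
    1ℚ + Σ[ xs ] (λ a → 𝟙 (not (b a)))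
  ∎

Π-if-count : (b : A → Bool) (r : ℚ) (xs : List A) →
  Π[ xs ] (λ a → if b a then r else 1ℚ) ≡ r ^ℚ count b xs
Π-if-count b r []       = refl
Π-if-count b r (a ∷ xs) with b a
... | true  = cong (r *_) (Π-if-count b r xs)
... | false = trans (ℚ.*-identityˡ _) (Π-if-count b r xs)

-- allFuns builds its functions with a pattern-matching lambda, which agrees with a ∷′ f only
-- pointwise; this is why summands over allFuns are required to respect _≗_.
Σ-allFuns-suc : (xs : List A) (F : (Fin (suc n) → A) → ℚ) → F Preserves _≗_ ⟶ _≡_ →
  Σ[ allFuns (suc n) xs ] F ≡ Σ[ xs ] (λ a → Σ[ allFuns n xs ] (λ f → F (a ∷′ f)))
Σ-allFuns-suc {n = n} xs F F-cong =
  trans (Σ-concatMap _ xs F) (Σ-cong xs (λ a →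
    trans (Σ-map _ (allFuns n xs) F)
          (Σ-cong (allFuns n xs) (λ f → F-cong λ { zero → refl ; (suc i) → refl }))))

Σ-allFuns-∏ : (xs : List A) (G : Fin n → A → ℚ) →
  Σ[ allFuns n xs ] (λ f → ∏ (λ i → G i (f i))) ≡ ∏ (λ i → Σ[ xs ] (G i))
Σ-allFuns-∏ {n = zero}  xs G = ℚ.+-identityʳ 1ℚ
Σ-allFuns-∏ {n = suc n} xs G = begin
    Σ[ allFuns (suc n) xs ] (λ f → ∏ (λ i → G i (f i)))
  ≡⟨ Σ-allFuns-suc xs _ (λ f≗g → ∏-cong (λ i → cong (G i) (f≗g i))) ⟩
    Σ[ xs ] (λ a → Σ[ allFuns n xs ] (λ f → G zero a * ∏ (λ i → G (suc i) (f i))))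
  ≡⟨ Σ-cong xs (λ a → sym (*-distribˡ-Σ (G zero a) (allFuns n xs) _)) ⟩
    Σ[ xs ] (λ a → G zero a * Σ[ allFuns n xs ] (λ f → ∏ (λ i → G (suc i) (f i))))
  ≡⟨ Σ-cong xs (λ a → cong (G zero a *_) (Σ-allFuns-∏ xs (G ∘ suc))) ⟩
    Σ[ xs ] (λ a → G zero a * ∏ (λ i → Σ[ xs ] (G (suc i))))
  ≡⟨ sym (*-distribʳ-Σ _ xs (G zero)) ⟩
    Σ[ xs ] (G zero) * ∏ (λ i → Σ[ xs ] (G (suc i)))
  ∎

weight : (A → ℚ) → (Fin n → A) → ℚ
weight ω f = ∏ (ω ∘ f)

weight-cong : (ω : A → ℚ) → weight {n = n} ω Preserves _≗_ ⟶ _≡_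
weight-cong ω f≗g = ∏-cong (cong ω ∘ f≗g)

Σ-weight-∏ : (xs : List A) (ω : A → ℚ) (G : Fin n → A → ℚ) →
  Σ[ allFuns n xs ] (λ f → weight ω f * ∏ (λ i → G i (f i)))
    ≡ ∏ (λ i → Σ[ xs ] (λ a → ω a * G i a))
Σ-weight-∏ xs ω G = trans
  (Σ-cong (allFuns _ xs) (λ f → sym (∏-distrib-* (ω ∘ f) (λ i → G i (f i)))))
  (Σ-allFuns-∏ xs (λ i a → ω a * G i a))

Σ-weight≡1 : (xs : List A) (ω : A → ℚ) → Σ[ xs ] ω ≡ 1ℚ →
  Σ[ allFuns n xs ] (weight ω) ≡ 1ℚ
Σ-weight≡1 {n = n} xs ω Σω≡1 =
  trans (Σ-allFuns-∏ {n = n} xs (λ _ → ω)) (trans (∏-cong {n = n} (λ _ → Σω≡1)) (∏-1 n))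

Σ-weight-suc : (xs : List A) (ω : A → ℚ) (F : (Fin (suc n) → A) → ℚ) →
  F Preserves _≗_ ⟶ _≡_ →
  Σ[ allFuns (suc n) xs ] (λ f → weight ω f * F f)
    ≡ Σ[ xs ] (λ a → ω a * Σ[ allFuns n xs ] (λ f → weight ω f * F (a ∷′ f)))
Σ-weight-suc {n = n} xs ω F F-cong = trans
  (Σ-allFuns-suc xs _ (λ f≗g → cong₂ _*_ (weight-cong ω f≗g) (F-cong f≗g)))
  (Σ-cong xs (λ a → trans
    (Σ-cong (allFuns n xs) (λ f → ℚ.*-assoc (ω a) (weight ω f) _))
    (sym (*-distribˡ-Σ (ω a) (allFuns n xs) _))))

column : (Fin n → Fin v → A) → Fin v → Fin n → A
column I j y = I y j

Σ-weight-columns : (xs : List A) (ω : A → ℚ) (g : Fin v → (Fin n → A) → ℚ) →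
  (∀ j → g j Preserves _≗_ ⟶ _≡_) →
  Σ[ allFuns n (allFuns v xs) ] (λ I → weight (weight ω) I * ∏ (λ j → g j (column I j)))
    ≡ ∏ (λ j → Σ[ allFuns n xs ] (λ c → weight ω c * g j c))
Σ-weight-columns {n = zero} xs ω g g-cong =
  trans (ℚ.+-identityʳ _) (trans (ℚ.*-identityˡ _) (∏-cong (λ j →
    trans (g-cong j (λ ())) (sym (trans (ℚ.+-identityʳ _) (ℚ.*-identityˡ _))))))
Σ-weight-columns {A = A} {v = v} {n = suc n} xs ω g g-cong = begin
    Σ[ allFuns (suc n) rows ] (λ I → weight (weight ω) I * ∏ (λ j → g j (column I j)))
  ≡⟨ Σ-weight-suc rows (weight ω) _
       (λ I≗J → ∏-cong (λ j → g-cong j (λ y → cong (λ r → r j) (I≗J y)))) ⟩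
    Σ[ rows ] (λ r → weight ω r *
      Σ[ allFuns n rows ] (λ I → weight (weight ω) I * ∏ (λ j → g j (column (r ∷′ I) j))))
  ≡⟨ Σ-cong rows (λ r → cong (weight ω r *_) (Σ-cong (allFuns n rows) (λ I →
       cong (weight (weight ω) I *_)
         (∏-cong (λ j → g-cong j λ { zero → refl ; (suc y) → refl }))))) ⟩
    Σ[ rows ] (λ r → weight ω r *
      Σ[ allFuns n rows ] (λ I → weight (weight ω) I * ∏ (λ j → g j (r j ∷′ column I j))))
  ≡⟨ Σ-cong rows (λ r → cong (weight ω r *_) (Σ-weight-columns xs ω (λ j c → g j (r j ∷′ c))
       (λ j c≗d → g-cong j λ { zero → refl ; (suc y) → c≗d y }))) ⟩
    Σ[ rows ] (λ r → weight ω r * ∏ (λ j → H j (r j)))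
  ≡⟨ Σ-weight-∏ xs ω H ⟩
    ∏ (λ j → Σ[ xs ] (λ b → ω b * H j b))
  ≡⟨ ∏-cong (λ j → sym (Σ-weight-suc xs ω (g j) (g-cong j))) ⟩
    ∏ (λ j → Σ[ allFuns (suc n) xs ] (λ c → weight ω c * g j c))
  ∎
  where
  rows : List (Fin v → A)
  rows = allFuns v xs
  H : Fin v → A → ℚ
  H j b = Σ[ allFuns n xs ] (λ c → weight ω c * g j (b ∷′ c))

survivalProb : ℚ → ℕ → ℚ
survivalProb q i = 1ℚ - q * (1ℚ - q) ^ℚ i

-- A column c of the test matrix is the incidence vector of a pool, and candidatePositive I P x
-- unfolds to all (λ j → survives P x (column I j)) (allFin v).
survives : Subset n → Fin n → (Fin n → Bool) → Bool
survives {n} P x c = if c x then any (λ y → c y ∧ P y) (allFin n) else true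

clears : Subset n → Fin n → (Fin n → Bool) → Bool
clears {n} P x c = c x ∧ all (λ y → not (c y ∧ P y)) (allFin n)

survives-cong : (P : Subset n) (x : Fin n) → survives P x Preserves _≗_ ⟶ _≡_
survives-cong P x c≗d = cong₂ (λ b a → if b then a else true) (c≗d x)
  (cong or (map-cong (λ y → cong (_∧ P y) (c≗d y)) (allFin _)))

𝟙-survives : (P : Subset n) (x : Fin n) (c : Fin n → Bool) →
  𝟙 (survives P x c) ≡ 1ℚ - 𝟙 (clears P x c)
𝟙-survives {n} P x c with c x
... | true  = trans (𝟙-any (λ y → c y ∧ P y) (allFin n))
                    (cong (1ℚ -_) (sym (𝟙-all (λ y → not (c y ∧ P y)) (allFin n))))
... | false = refl

matrixProb≡weight : (q : ℚ) (I : Matrix n v) → matrixProb q I ≡ weight (weight (entryProb q)) I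
matrixProb≡weight {n} {v} q I = trans
  (Π-tabulate id (λ y → Π[ allFin v ] (λ j → entryProb q (I y j))))
  (∏-cong (λ y → Π-tabulate id (λ j → entryProb q (I y j))))

𝟙-candidatePositive : (I : Matrix n v) (P : Subset n) (x : Fin n) →
  𝟙 (candidatePositive I P x) ≡ ∏ (λ j → 𝟙 (survives P x (column I j)))
𝟙-candidatePositive {v = v} I P x =
  trans (𝟙-all (λ j → survives P x (column I j)) (allFin v))
        (Π-tabulate id (λ j → 𝟙 (survives P x (column I j))))

module _ (q : ℚ) {n : ℕ} (P : Subset n) (x : Fin n) (x∉P : P x ≡ false) where

  private
    pools : List (Fin n → Bool)
    pools = allFuns n bools

    w : (Fin n → Bool) → ℚ
    w = weight (entryProb q)

  clearing-probability : Σ[ pools ] (λ c → w c * 𝟙 (clears P x c)) ≡ q * (1ℚ - q) ^ℚ card P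
  clearing-probability = begin
      Σ[ pools ] (λ c → w c * 𝟙 (clears P x c))
    ≡⟨ Σ-cong pools (λ c → cong (w c *_) (𝟙-clears c)) ⟩
      Σ[ pools ] (λ c → w c * ∏ (λ y → φ y (c y)))
    ≡⟨ Σ-weight-∏ bools (entryProb q) φ ⟩
      ∏ (λ y → Σ[ bools ] (λ b → entryProb q b * φ y b))
    ≡⟨ ∏-cong Σ-φ ⟩
      ∏ (λ y → δ q y * ρ y)
    ≡⟨ ∏-distrib-* (δ q) ρ ⟩
      ∏ (δ q) * ∏ ρ
    ≡⟨ cong₂ _*_ (∏-δ x (λ _ → q))
                 (trans (sym (Π-tabulate id ρ)) (Π-if-count P (1ℚ - q) (allFin n))) ⟩
      q * (1ℚ - q) ^ℚ card P
    ∎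
    where
    δ : ℚ → Fin n → ℚ
    δ a y = if does (x ≟ y) then a else 1ℚ

    ρ : Fin n → ℚ
    ρ y = if P y then 1ℚ - q else 1ℚ

    φ : Fin n → Bool → ℚ
    φ y b = δ (𝟙 b) y * 𝟙 (not (b ∧ P y))

    𝟙-clears : ∀ c → 𝟙 (clears P x c) ≡ ∏ (λ y → φ y (c y))
    𝟙-clears c = begin
        𝟙 (c x ∧ all (λ y → not (c y ∧ P y)) (allFin n))
      ≡⟨ 𝟙-∧ (c x) _ ⟩
        𝟙 (c x) * 𝟙 (all (λ y → not (c y ∧ P y)) (allFin n))
      ≡⟨ cong₂ _*_ (sym (∏-δ x (𝟙 ∘ c)))
           (trans (𝟙-all (λ y → not (c y ∧ P y)) (allFin n))
                  (Π-tabulate id (λ y → 𝟙 (not (c y ∧ P y))))) ⟩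
        ∏ (λ y → δ (𝟙 (c y)) y) * ∏ (λ y → 𝟙 (not (c y ∧ P y)))
      ≡⟨ sym (∏-distrib-* (λ y → δ (𝟙 (c y)) y) (λ y → 𝟙 (not (c y ∧ P y)))) ⟩
        ∏ (λ y → φ y (c y))
      ∎

    Σ-φ : ∀ y → Σ[ bools ] (λ b → entryProb q b * φ y b) ≡ δ q y * ρ y
    Σ-φ y with x ≟ y
    ... | yes refl rewrite x∉P =
      solve 1 (λ q → q :* con 1ℚ :+ ((con 1ℚ :- q) :* con 0ℚ :+ con 0ℚ) := q :* con 1ℚ) refl q
    ... | no _ with P y
    ...   | true  =
      solve 1 (λ q → q :* con 0ℚ :+ ((con 1ℚ :- q) :* con 1ℚ :+ con 0ℚ) := con 1ℚ :* (con 1ℚ :- q)) refl q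
    ...   | false =
      solve 1 (λ q → q :* con 1ℚ :+ ((con 1ℚ :- q) :* con 1ℚ :+ con 0ℚ) := con 1ℚ :* con 1ℚ) refl q

  survival-probability : Σ[ pools ] (λ c → w c * 𝟙 (survives P x c)) ≡ survivalProb q (card P)
  survival-probability = begin
      Σ[ pools ] (λ c → w c * 𝟙 (survives P x c))
    ≡⟨ Σ-cong pools (λ c → trans (cong (w c *_) (𝟙-survives P x c))
         (solve 2 (λ a b → a :* (con 1ℚ :- b) := a :- a :* b) refl (w c) (𝟙 (clears P x c)))) ⟩
      Σ[ pools ] (λ c → w c - w c * 𝟙 (clears P x c))
    ≡⟨ Σ-distrib-minus pools w (λ c → w c * 𝟙 (clears P x c)) ⟩
      Σ[ pools ] w - Σ[ pools ] (λ c → w c * 𝟙 (clears P x c))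
    ≡⟨ cong₂ _-_ (Σ-weight≡1 {n = n} bools (entryProb q) Σ-entryProb) clearing-probability ⟩
      survivalProb q (card P)
    ∎
    where
    Σ-entryProb : Σ[ bools ] (entryProb q) ≡ 1ℚ
    Σ-entryProb = solve 1 (λ q → q :+ (con 1ℚ :- q :+ con 0ℚ) := con 1ℚ) refl q

  candidate-probability :
    Σ[ allMatrices n v ] (λ I → matrixProb q I * 𝟙 (candidatePositive I P x))
      ≡ survivalProb q (card P) ^ℚ v
  candidate-probability {v} = begin
      Σ[ allMatrices n v ] (λ I → matrixProb q I * 𝟙 (candidatePositive I P x))
    ≡⟨ Σ-cong (allMatrices n v) (λ I →
         cong₂ _*_ (matrixProb≡weight q I) (𝟙-candidatePositive I P x)) ⟩
      Σ[ allMatrices n v ] (λ I → weight (weight (entryProb q)) I * ∏ (λ j → 𝟙 (survives P x (column I j))))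
    ≡⟨ Σ-weight-columns bools (entryProb q) (λ _ → 𝟙 ∘ survives P x)
         (λ _ → cong 𝟙 ∘ survives-cong P x) ⟩
      ∏ (λ (_ : Fin v) → Σ[ pools ] (λ c → w c * 𝟙 (survives P x c)))
    ≡⟨ ∏-cong {n = v} (λ _ → survival-probability) ⟩
      ∏ (λ (_ : Fin v) → survivalProb q (card P))
    ≡⟨ ∏-const {n = v} (survivalProb q (card P)) ⟩
      survivalProb q (card P) ^ℚ v
    ∎

unresolved-probability : (q : ℚ) (P : Subset n) (x : Fin n) →
  Σ[ allMatrices n v ] (λ I → matrixProb q I * 𝟙 (unresolvedNegative I P x))
    ≡ 𝟙 (not (P x)) * survivalProb q (card P) ^ℚ v
unresolved-probability {n} {v} q P x = begin
    Σ[ allMatrices n v ] (λ I → matrixProb q I * 𝟙 (candidatePositive I P x ∧ not (P x)))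
  ≡⟨ Σ-cong (allMatrices n v) (λ I → trans (cong (matrixProb q I *_) (𝟙-∧ (candidate I) (not (P x))))
       (sym (ℚ.*-assoc (matrixProb q I) (𝟙 (candidate I)) (𝟙 (not (P x)))))) ⟩
    Σ[ allMatrices n v ] (λ I → matrixProb q I * 𝟙 (candidate I) * 𝟙 (not (P x)))
  ≡⟨ sym (*-distribʳ-Σ (𝟙 (not (P x))) (allMatrices n v) (λ I → matrixProb q I * 𝟙 (candidate I))) ⟩
    pᶜ * 𝟙 (not (P x))
  ≡⟨ ℚ.*-comm pᶜ (𝟙 (not (P x))) ⟩
    𝟙 (not (P x)) * pᶜ
  ≡⟨ only-negatives (P x) refl ⟩
    𝟙 (not (P x)) * survivalProb q (card P) ^ℚ v
  ∎
  where
  candidate : Matrix n v → Bool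
  candidate I = candidatePositive I P x

  pᶜ : ℚ
  pᶜ = Σ[ allMatrices n v ] (λ I → matrixProb q I * 𝟙 (candidate I))

  only-negatives : ∀ b → P x ≡ b → 𝟙 (not b) * pᶜ ≡ 𝟙 (not b) * survivalProb q (card P) ^ℚ v
  only-negatives true  _   = trans (ℚ.*-zeroˡ pᶜ) (sym (ℚ.*-zeroˡ (survivalProb q (card P) ^ℚ v)))
  only-negatives false x∉P = cong (1ℚ *_) (candidate-probability q P x x∉P)

expected-unresolved-given : (q : ℚ) (P : Subset n) →
  Σ[ allMatrices n v ] (λ I → matrixProb q I * ℕ→ℚ (numUnresolved I P))
    ≡ ℕ→ℚ (n ∸ card P) * survivalProb q (card P) ^ℚ v
expected-unresolved-given {n} {v} q P = begin
    Σ[ allMatrices n v ] (λ I → matrixProb q I * ℕ→ℚ (numUnresolved I P))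
  ≡⟨ Σ-cong (allMatrices n v) (λ I → trans
       (cong (matrixProb q I *_) (ℕ→ℚ-count (unresolvedNegative I P) (allFin n)))
       (*-distribˡ-Σ (matrixProb q I) (allFin n) (𝟙 ∘ unresolvedNegative I P))) ⟩
    Σ[ allMatrices n v ] (λ I → Σ[ allFin n ] (λ x → u I x))
  ≡⟨ Σ-comm (allMatrices n v) (allFin n) u ⟩
    Σ[ allFin n ] (λ x → Σ[ allMatrices n v ] (λ I → u I x))
  ≡⟨ Σ-cong (allFin n) (unresolved-probability q P) ⟩
    Σ[ allFin n ] (λ x → 𝟙 (not (P x)) * r)
  ≡⟨ sym (*-distribʳ-Σ r (allFin n) (λ x → 𝟙 (not (P x)))) ⟩
    Σ[ allFin n ] (λ x → 𝟙 (not (P x))) * r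
  ≡⟨ cong (_* r) (sym (ℕ→ℚ-length∸count P (allFin n))) ⟩
    ℕ→ℚ (length (allFin n) ∸ card P) * r
  ≡⟨ cong (λ m → ℕ→ℚ (m ∸ card P) * r) (length-tabulate id) ⟩
    ℕ→ℚ (n ∸ card P) * r
  ∎
  where
  u : Matrix n v → Fin n → ℚ
  u I x = matrixProb q I * 𝟙 (unresolvedNegative I P x)

  r : ℚ
  r = survivalProb q (card P) ^ℚ v

Σ≤-cong : (n : ℕ) {f g : ℕ → ℚ} → f ≗ g → Σ≤ n f ≡ Σ≤ n g
Σ≤-cong zero    f≗g = f≗g zero
Σ≤-cong (suc n) f≗g = cong₂ _+_ (Σ≤-cong n f≗g) (f≗g (suc n))

Σ≤-comm : (n : ℕ) (xs : List A) (f : ℕ → A → ℚ) →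
  Σ≤ n (λ i → Σ[ xs ] (f i)) ≡ Σ[ xs ] (λ a → Σ≤ n (λ i → f i a))
Σ≤-comm zero    xs f = refl
Σ≤-comm (suc n) xs f = trans
  (cong (_+ Σ[ xs ] (f (suc n))) (Σ≤-comm n xs f))
  (sym (Σ-distrib-+ xs (λ a → Σ≤ n (λ i → f i a)) (f (suc n))))

Σ≤-zero : (n : ℕ) (f : ℕ → ℚ) → (∀ i → i ℕ.≤ n → f i ≡ 0ℚ) → Σ≤ n f ≡ 0ℚ
Σ≤-zero zero    f f≡0 = f≡0 zero ℕ.z≤n
Σ≤-zero (suc n) f f≡0 = trans
  (cong₂ _+_ (Σ≤-zero n f (λ i i≤n → f≡0 i (m≤n⇒m≤1+n i≤n))) (f≡0 (suc n) ≤-refl))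
  (ℚ.+-identityˡ 0ℚ)

Σ≤-single : ∀ {k} n (f : ℕ → ℚ) → k ℕ.≤ n → (∀ i → k ≢ i → f i ≡ 0ℚ) → Σ≤ n f ≡ f k
Σ≤-single zero    f ℕ.z≤n f≡0 = refl
Σ≤-single (suc n) f k≤1+n f≡0 with m≤n⇒m<n∨m≡n k≤1+n
... | inj₁ k<1+n = trans
  (cong₂ _+_ (Σ≤-single n f (≤-pred k<1+n) f≡0) (f≡0 (suc n) (<⇒≢ k<1+n)))
  (ℚ.+-identityʳ _)
... | inj₂ refl  = trans
  (cong (_+ f (suc n))
    (Σ≤-zero n f (λ i i≤n → f≡0 i (λ 1+n≡i → <⇒≢ (ℕ.s≤s i≤n) (sym 1+n≡i)))))
  (ℚ.+-identityˡ (f (suc n)))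

Σ≤-select : ∀ {k} n → k ℕ.≤ n → (a : ℚ) (f : ℕ → ℚ) →
  Σ≤ n (λ i → (if k ≡ᵇ i then a else 0ℚ) * f i) ≡ a * f k
Σ≤-select {k} n k≤n a f = trans
  (Σ≤-single n _ k≤n (λ i k≢i →
    trans (cong (λ b → (if b then a else 0ℚ) * f i) (dec-false (k ℕ.≟ i) k≢i)) (ℚ.*-zeroˡ (f i))))
  (cong (λ b → (if b then a else 0ℚ) * f k) (dec-true (k ℕ.≟ k) refl))

Σ-fibres : (xs : List A) (κ : A → ℕ) → (∀ a → κ a ℕ.≤ n) → (μ : A → ℚ) (f : ℕ → ℚ) →
  Σ[ xs ] (λ a → μ a * f (κ a))
    ≡ Σ≤ n (λ i → Σ[ xs ] (λ a → if κ a ≡ᵇ i then μ a else 0ℚ) * f i)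
Σ-fibres {A = A} {n = n} xs κ κ≤n μ f = begin
    Σ[ xs ] (λ a → μ a * f (κ a))
  ≡⟨ Σ-cong xs (λ a → sym (Σ≤-select n (κ≤n a) (μ a) f)) ⟩
    Σ[ xs ] (λ a → Σ≤ n (λ i → fibre i a * f i))
  ≡⟨ sym (Σ≤-comm n xs (λ i a → fibre i a * f i)) ⟩
    Σ≤ n (λ i → Σ[ xs ] (λ a → fibre i a * f i))
  ≡⟨ Σ≤-cong n (λ i → sym (*-distribʳ-Σ (f i) xs (fibre i))) ⟩
    Σ≤ n (λ i → Σ[ xs ] (fibre i) * f i)
  ∎
  where
  fibre : ℕ → A → ℚ
  fibre i a = if κ a ≡ᵇ i then μ a else 0ℚ

card≤n : (P : Subset n) → card P ℕ.≤ n
card≤n {n} P = subst (card P ℕ.≤_) (length-tabulate id) (count≤length P (allFin n))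

-- The identity is polynomial in q and linear in μ, so it holds without the probabilistic hypotheses.
lemma4p1 : (n v : ℕ) → v ≥ 1 → (q : ℚ) → 0ℚ ≤ q → q ≤ 1ℚ →
    (μ : Subset n → ℚ) → (∀ P → 0ℚ ≤ μ P) → Σ[ allSubsets n ] μ ≡ 1ℚ →
    expectedUnresolved n v q μ
      ≡ Σ≤ n (λ i → sizeProb μ i * ℕ→ℚ (n ∸ i) * ((1ℚ - q * ((1ℚ - q) ^ℚ i)) ^ℚ v))
lemma4p1 n v _ q _ _ μ _ _ = begin
    expectedUnresolved n v q μ
  ≡⟨ Σ-cong (allSubsets n) (λ P → trans
       (Σ-cong (allMatrices n v) (λ I → ℚ.*-assoc (μ P) (matrixProb q I) _))
       (sym (*-distribˡ-Σ (μ P) (allMatrices n v) _))) ⟩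
    Σ[ allSubsets n ] (λ P →
      μ P * Σ[ allMatrices n v ] (λ I → matrixProb q I * ℕ→ℚ (numUnresolved I P)))
  ≡⟨ Σ-cong (allSubsets n) (λ P → cong (μ P *_) (expected-unresolved-given q P)) ⟩
    Σ[ allSubsets n ] (λ P → μ P * f (card P))
  ≡⟨ Σ-fibres (allSubsets n) card card≤n μ f ⟩
    Σ≤ n (λ i → sizeProb μ i * f i)
  ≡⟨ Σ≤-cong n (λ i → sym (ℚ.*-assoc (sizeProb μ i) _ _)) ⟩
    Σ≤ n (λ i → sizeProb μ i * ℕ→ℚ (n ∸ i) * survivalProb q i ^ℚ v)
  ∎
  where
  f : ℕ → ℚ
  f i = ℕ→ℚ (n ∸ i) * survivalProb q i ^ℚ v
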